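{- Let $G=(V,E)$ be a simple undirected graph, let $S\subseteq\binom{V}{2}$ be a set of terminal pairs, and let $a^{\mathsf T}x\geq b$ be facet-defining for $\mathrm{MultC}(G,S)$. Then the facet $\{x:a^{\mathsf T}x=b\}\cap\mathrm{MultC}(G,S)$ is bounded if and only if $\mathrm{supp}(a)=G$.
   Context: Given a graph $G=(V,E)$ and $S\subseteq\binom{V}{2}$, an ($S$-)multicut is a set $\delta\subseteq E$ such that for every $\{s,t\}\in S$ the nodes $s$ and $t$ lie in different components of $G-\delta$. For $F\subseteq E$, $x^F\in\mathbb{R}^E$ is its incidence vector. The multicut dominant is $\mathrm{MultC}(G,S)=\mathrm{conv}\{x^\delta:\delta \text{ an } S\text{ -multicut}\}+\mathbb{R}^E_{\geq 0}$. For a valid inequality $a^{\mathsf T}x\geq b$, $\mathrm{supp}(a)$ is the subgraph of $G$ induced by the edge set $\{e\in E:a_e\neq 0\}$.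
   Formalization: The coefficients of $a^{\mathsf T}x\geq b$ are rational, and the points of $\mathrm{MultC}(G,S)$ and of its facets are taken in ℚ^E instead of ℝ^E. -}

module Defs where

open import Data.Nat using (ℕ; zero; suc)
open import Data.Fin using (Fin; zero; suc)
open import Data.Bool using (Bool; true; false)
open import Data.Product using (Σ; ∃; ∃-syntax; _×_; _,_; proj₁; proj₂)
open import Data.Sum using (_⊎_)
open import Data.List using (List)
open import Data.List.Membership.Propositional using (_∈_)
open import Data.Rational using (ℚ; 0ℚ; 1ℚ; _+_; _*_; _-_; _≤_; ∣_∣)
open import Relation.Binary.PropositionalEquality using (_≡_; _≢_)
open import Relation.Nullary using (¬_)

Σℚ : ∀ {k} → (Fin k → ℚ) → ℚ
Σℚ {zero}  f = 0ℚ
Σℚ {suc k} f = f zero + Σℚ (λ i → f (suc i))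

record Graph : Set where
  field
    n    : ℕ
    m    : ℕ
    ends : Fin m → Fin n × Fin n

open Graph public

Joins : (G : Graph) → Fin (m G) → Fin (n G) → Fin (n G) → Set
Joins G e u w = ends G e ≡ (u , w) ⊎ ends G e ≡ (w , u)

Simple : Graph → Set
Simple G = (∀ e → proj₁ (ends G e) ≢ proj₂ (ends G e))
         × (∀ e f u w → Joins G e u w → Joins G f u w → e ≡ f)

TerminalPairs : Graph → Set
TerminalPairs G = List (Fin (n G) × Fin (n G))

DistinctPairs : (G : Graph) → TerminalPairs G → Set
DistinctPairs G S = ∀ {s t} → (s , t) ∈ S → s ≢ t

EdgeSet : Graph → Set
EdgeSet G = Fin (m G) → Bool

data Reach (G : Graph) (δ : EdgeSet G) : Fin (n G) → Fin (n G) → Set where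
  here : ∀ {u} → Reach G δ u u
  step : ∀ {u w v} e → δ e ≡ false → Joins G e u w → Reach G δ w v → Reach G δ u v

IsMulticut : (G : Graph) → TerminalPairs G → EdgeSet G → Set
IsMulticut G S δ = ∀ {s t} → (s , t) ∈ S → ¬ Reach G δ s t

Point : Graph → Set
Point G = Fin (m G) → ℚ

incidence : (G : Graph) → EdgeSet G → Point G
incidence G δ e with δ e
... | true  = 1ℚ
... | false = 0ℚ

-- MultC(G,S) = conv{x^δ : δ multicut} + ℚ^E_{≥0}:
-- x dominates a convex combination of finitely many multicut incidence vectors.
InMultC : (G : Graph) → TerminalPairs G → Point G → Set
InMultC G S x =
  Σ ℕ λ k → Σ (Fin k → EdgeSet G) λ δ → Σ (Fin k → ℚ) λ λ' →
      (∀ i → IsMulticut G S (δ i))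
    × (∀ i → 0ℚ ≤ λ' i)
    × (Σℚ λ' ≡ 1ℚ)
    × (∀ e → Σℚ (λ i → λ' i * incidence G (δ i) e) ≤ x e)

dot : (G : Graph) → Point G → Point G → ℚ
dot G a x = Σℚ (λ e → a e * x e)

AffinelyIndependent : (G : Graph) → ∀ {r} → (Fin r → Point G) → Set
AffinelyIndependent G {r} p =
  ∀ (μ : Fin r → ℚ) → Σℚ μ ≡ 0ℚ → (∀ e → Σℚ (λ i → μ i * p i e) ≡ 0ℚ) →
  ∀ i → μ i ≡ 0ℚ

HasAffIndep : (G : Graph) → (Point G → Set) → ℕ → Set
HasAffIndep G X r = Σ (Fin r → Point G) λ p → (∀ i → X (p i)) × AffinelyIndependent G p

-- AffRank G X r : the maximum number of affinely independent points of X is r,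
-- i.e. dim X = r - 1 (with r = 0 for the empty set).
AffRank : (G : Graph) → (Point G → Set) → ℕ → Set
AffRank G X r = HasAffIndep G X r × ¬ HasAffIndep G X (suc r)

Valid : (G : Graph) → TerminalPairs G → Point G → ℚ → Set
Valid G S a b = ∀ x → InMultC G S x → b ≤ dot G a x

Face : (G : Graph) → TerminalPairs G → Point G → ℚ → Point G → Set
Face G S a b x = InMultC G S x × dot G a x ≡ b

-- Facet-defining: valid, and dim(face) = dim(MultC) - 1.
FacetDefining : (G : Graph) → TerminalPairs G → Point G → ℚ → Set
FacetDefining G S a b =
  Valid G S a b ×
  Σ ℕ λ r → AffRank G (InMultC G S) (suc r) × AffRank G (Face G S a b) r

Bounded : (G : Graph) → (Point G → Set) → Set
Bounded G X = Σ ℚ λ M → ∀ x → X x → ∀ e → ∣ x e ∣ ≤ M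

-- supp(a) = G, read as: the edge set {e : a_e ≠ 0} is all of E.
SuppIsG : (G : Graph) → Point G → Set
SuppIsG G a = ∀ e → a e ≢ 0ℚ

-- The multicut dominant is up-closed: with x it contains x + t χ^e for all t ≥ 0.
-- Hence a valid inequality a·x ≥ b has a ≥ 0, and if a_e = 0 the face contains
-- the whole ray x + t χ^e through any of its points, so it is unbounded.
-- Conversely, if every a_e > 0 then on the face a_e x_e ≤ a·x = b, so x_e ≤ b / a_e.
module Submission where

open import Defs
open import Data.Rational using (ℚ)
open import Function.Bundles using (_⇔_)

open import Data.Bool using (true; false)
import Data.Nat as ℕ
open import Data.Fin using (Fin; zero; suc)
open import Data.Product using (_,_; proj₁)
open import Data.Rational
  using (0ℚ; 1ℚ; _+_; _*_; _-_; -_; _≤_; _<_; ∣_∣; 1/_; Positive; NonZero;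
         ≢-nonZero; positive; nonNegative)
open import Data.Rational.Properties
open import Data.Rational.Solver using (module +-*-Solver)
open import Data.Sum using (inj₁; inj₂)
open import Data.Vec.Functional using (Vector; updateAt; _∷_; [])
open import Data.Vec.Functional.Properties using (updateAt-updates)
open import Function.Bundles using (mk⇔)
open import Relation.Binary.PropositionalEquality
  using (_≡_; refl; sym; cong; cong₂; subst; module ≡-Reasoning)
open import Relation.Nullary using (¬_; yes; no)

open +-*-Solver using (solve; _:+_; _:*_; :-_; _:=_; con)

p≤p+q : ∀ {p q} → 0ℚ ≤ q → p ≤ p + q
p≤p+q {p} {q} 0≤q = subst (_≤ p + q) (+-identityʳ p) (+-monoʳ-≤ p 0≤q)

p≤q+p : ∀ {p q} → 0ℚ ≤ q → p ≤ q + p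
p≤q+p {p} {q} 0≤q = subst (_≤ q + p) (+-identityˡ p) (+-monoˡ-≤ p 0≤q)

p<p+1 : ∀ p → p < p + 1ℚ
p<p+1 p = subst (_< p + 1ℚ) (+-identityʳ p) (+-monoʳ-< p (positive⁻¹ 1ℚ))

p≤∣p∣ : ∀ p → p ≤ ∣ p ∣
p≤∣p∣ p with ≤-total 0ℚ p
... | inj₁ 0≤p = ≤-reflexive (sym (0≤p⇒∣p∣≡p 0≤p))
... | inj₂ p≤0 = ≤-trans p≤0 (0≤∣p∣ p)

*-nonNeg : ∀ {p q} → 0ℚ ≤ p → 0ℚ ≤ q → 0ℚ ≤ p * q
*-nonNeg {p} {q} 0≤p 0≤q =
  nonNegative⁻¹ (p * q) {{nonNeg*nonNeg⇒nonNeg p {{nonNegative 0≤p}} q {{nonNegative 0≤q}}}}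

r*p≤q⇒p≤1/r*q : ∀ r .{{_ : Positive r}} {p q} → r * p ≤ q → p ≤ (1/ r) {{pos⇒nonZero r}} * q
r*p≤q⇒p≤1/r*q r {p} {q} rp≤q = *-cancelˡ-≤-pos r (subst (r * p ≤_) (sym r*[1/r*q]≡q) rp≤q)
  where
  instance
    r≢0 : NonZero r
    r≢0 = pos⇒nonZero r
  open ≡-Reasoning
  r*[1/r*q]≡q : r * (1/ r * q) ≡ q
  r*[1/r*q]≡q = begin
    r * (1/ r * q)  ≡⟨ *-assoc r (1/ r) q ⟨
    r * 1/ r * q    ≡⟨ cong (_* q) (*-inverseʳ r) ⟩
    1ℚ * q          ≡⟨ *-identityˡ q ⟩
    q               ∎

slope-nonNeg : ∀ {b d c} → (∀ t → 0ℚ ≤ t → b ≤ d + c * t) → 0ℚ ≤ c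
slope-nonNeg {b} {d} {c} above-b with 0ℚ ≤? c
... | yes 0≤c = 0≤c
... | no 0≰c = begin-contradiction
    b               ≤⟨ above-b t 0≤t ⟩
    d + c * t       ≡⟨ cong (d +_) c*t≡-∣s∣ ⟩
    d - ∣ s ∣       ≤⟨ +-monoʳ-≤ d (neg-antimono-≤ (p≤∣p∣ s)) ⟩
    d - s           ≡⟨ solve 2 (λ d b → d :+ (:- (d :+ (:- b) :+ con 1ℚ)) := b :+ (:- con 1ℚ)) refl d b ⟩
    b - 1ℚ          <⟨ +-monoʳ-< b (neg-antimono-< (positive⁻¹ 1ℚ)) ⟩
    b + 0ℚ          ≡⟨ +-identityʳ b ⟩
    b               ∎
  where
  open ≤-Reasoning
  instance
    -c-positive : Positive (- c)
    -c-positive = positive (neg-antimono-< (≰⇒> 0≰c))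
    -c-nonZero : NonZero (- c)
    -c-nonZero = pos⇒nonZero (- c)
  s = d - b + 1ℚ
  t = ∣ s ∣ * 1/ (- c)
  0≤t : 0ℚ ≤ t
  0≤t = *-nonNeg (0≤∣p∣ s) (<⇒≤ (positive⁻¹ (1/ (- c)) {{1/pos⇒pos (- c)}}))
  c*t≡-∣s∣ : c * t ≡ - ∣ s ∣
  c*t≡-∣s∣ = begin-equality
    c * (∣ s ∣ * 1/ (- c))          ≡⟨ solve 3 (λ c s i → c :* (s :* i) := :- (s :* ((:- c) :* i))) refl c ∣ s ∣ (1/ (- c)) ⟩
    - (∣ s ∣ * (- c * 1/ (- c)))    ≡⟨ cong (λ u → - (∣ s ∣ * u)) (*-inverseʳ (- c)) ⟩
    - (∣ s ∣ * 1ℚ)                  ≡⟨ cong -_ (*-identityʳ ∣ s ∣) ⟩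
    - ∣ s ∣                         ∎

Σℚ-nonNeg : ∀ {k} (f : Vector ℚ k) → (∀ i → 0ℚ ≤ f i) → 0ℚ ≤ Σℚ f
Σℚ-nonNeg {ℕ.zero}  f f≥0 = ≤-refl
Σℚ-nonNeg {ℕ.suc k} f f≥0 =
  ≤-trans (f≥0 zero) (p≤p+q (Σℚ-nonNeg (λ i → f (suc i)) (λ i → f≥0 (suc i))))

term≤Σℚ : ∀ {k} (f : Vector ℚ k) → (∀ i → 0ℚ ≤ f i) → ∀ j → f j ≤ Σℚ f
term≤Σℚ f f≥0 zero    = p≤p+q (Σℚ-nonNeg (λ i → f (suc i)) (λ i → f≥0 (suc i)))
term≤Σℚ f f≥0 (suc j) =
  ≤-trans (term≤Σℚ (λ i → f (suc i)) (λ i → f≥0 (suc i)) j) (p≤q+p (f≥0 zero))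

Σℚ-*-updateAt-+ : ∀ {k} (a x : Vector ℚ k) e t →
  Σℚ (λ i → a i * updateAt x e (_+ t) i) ≡ Σℚ (λ i → a i * x i) + a e * t
Σℚ-*-updateAt-+ a x zero t =
  solve 4 (λ a₀ x₀ t r → a₀ :* (x₀ :+ t) :+ r := (a₀ :* x₀ :+ r) :+ a₀ :* t) refl
    (a zero) (x zero) t (Σℚ (λ i → a (suc i) * x (suc i)))
Σℚ-*-updateAt-+ a x (suc e) t = begin
  a zero * x zero + Σℚ (λ i → a (suc i) * updateAt (λ i → x (suc i)) e (_+ t) i)
    ≡⟨ cong (a zero * x zero +_) (Σℚ-*-updateAt-+ (λ i → a (suc i)) (λ i → x (suc i)) e t) ⟩
  a zero * x zero + (Σℚ (λ i → a (suc i) * x (suc i)) + a (suc e) * t)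
    ≡⟨ +-assoc (a zero * x zero) _ _ ⟨
  a zero * x zero + Σℚ (λ i → a (suc i) * x (suc i)) + a (suc e) * t
    ∎
  where open ≡-Reasoning

≤-updateAt-+ : ∀ {k t} → 0ℚ ≤ t → (x : Vector ℚ k) → ∀ e i → x i ≤ updateAt x e (_+ t) i
≤-updateAt-+ 0≤t x zero    zero    = p≤p+q 0≤t
≤-updateAt-+ 0≤t x zero    (suc i) = ≤-refl
≤-updateAt-+ 0≤t x (suc e) zero    = ≤-refl
≤-updateAt-+ 0≤t x (suc e) (suc i) = ≤-updateAt-+ 0≤t (λ i → x (suc i)) e i

module _ (G : Graph) (S : TerminalPairs G) where

  incidence-nonNeg : ∀ δ e → 0ℚ ≤ incidence G δ e
  incidence-nonNeg δ e with δ e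
  ... | true  = nonNegative⁻¹ 1ℚ
  ... | false = ≤-refl

  InMultC-nonNeg : ∀ {x} → InMultC G S x → ∀ e → 0ℚ ≤ x e
  InMultC-nonNeg (_ , δ , λ′ , _ , λ′≥0 , _ , dominated) e =
    ≤-trans (Σℚ-nonNeg _ (λ i → *-nonNeg (λ′≥0 i) (incidence-nonNeg (δ i) e))) (dominated e)

  InMultC-upClosed : ∀ {x y} → InMultC G S x → (∀ e → x e ≤ y e) → InMultC G S y
  InMultC-upClosed (k , δ , λ′ , cuts , λ′≥0 , Σλ′≡1 , dominated) x≤y =
    k , δ , λ′ , cuts , λ′≥0 , Σλ′≡1 , λ e → ≤-trans (dominated e) (x≤y e)

  InMultC-ray : ∀ {x t} e → 0ℚ ≤ t → InMultC G S x → InMultC G S (updateAt x e (_+ t))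
  InMultC-ray {x} e 0≤t x∈ = InMultC-upClosed x∈ (≤-updateAt-+ 0≤t x e)

  Valid⇒nonNeg : ∀ a {b x} → Valid G S a b → InMultC G S x → ∀ e → 0ℚ ≤ a e
  Valid⇒nonNeg a {b} {x} valid x∈ e = slope-nonNeg {d = dot G a x} λ t 0≤t →
    subst (b ≤_) (Σℚ-*-updateAt-+ a x e t) (valid _ (InMultC-ray e 0≤t x∈))

  Face-ray : ∀ a {b x t} e → a e ≡ 0ℚ → 0ℚ ≤ t → Face G S a b x →
             Face G S a b (updateAt x e (_+ t))
  Face-ray a {b} {x} {t} e aₑ≡0 0≤t (x∈ , a·x≡b) = InMultC-ray e 0≤t x∈ , (begin
    dot G a (updateAt x e (_+ t))  ≡⟨ Σℚ-*-updateAt-+ a x e t ⟩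
    dot G a x + a e * t            ≡⟨ cong (λ aₑ → dot G a x + aₑ * t) aₑ≡0 ⟩
    dot G a x + 0ℚ * t             ≡⟨ cong (dot G a x +_) (*-zeroˡ t) ⟩
    dot G a x + 0ℚ                 ≡⟨ +-identityʳ (dot G a x) ⟩
    dot G a x                      ≡⟨ a·x≡b ⟩
    b                              ∎)
    where open ≡-Reasoning

ray⇒¬Bounded : (G : Graph) (X : Point G → Set) (y : Point G) (e : Fin (m G)) → 0ℚ ≤ y e →
               (∀ t → 0ℚ ≤ t → X (updateAt y e (_+ t))) → ¬ Bounded G X
ray⇒¬Bounded G X y e 0≤yₑ ray⊆X (M , bounded) = begin-contradiction
  t                             ≤⟨ p≤q+p 0≤yₑ ⟩
  y e + t                       ≡⟨ updateAt-updates e y ⟨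
  updateAt y e (_+ t) e         ≤⟨ p≤∣p∣ _ ⟩
  ∣ updateAt y e (_+ t) e ∣     ≤⟨ bounded _ (ray⊆X t 0≤t) e ⟩
  M                             ≤⟨ p≤∣p∣ M ⟩
  ∣ M ∣                         <⟨ p<p+1 ∣ M ∣ ⟩
  t                             ∎
  where
  open ≤-Reasoning
  t = ∣ M ∣ + 1ℚ
  0≤t : 0ℚ ≤ t
  0≤t = ≤-trans (0≤∣p∣ M) (<⇒≤ (p<p+1 ∣ M ∣))

updateAt-+1-affinelyIndependent : (G : Graph) (x : Point G) (e : Fin (m G)) →
  AffinelyIndependent G (x ∷ updateAt x e (_+ 1ℚ) ∷ [])
updateAt-+1-affinelyIndependent G x e μ Σμ≡0 combination≡0 = λ where
    zero       → μ₀≡0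
    (suc zero) → μ₁≡0
  where
  open ≡-Reasoning
  μ₀ = μ zero
  μ₁ = μ (suc zero)
  combination-at-e : μ₀ * x e + (μ₁ * (x e + 1ℚ) + 0ℚ) ≡ 0ℚ
  combination-at-e = subst (λ xₑ′ → μ₀ * x e + (μ₁ * xₑ′ + 0ℚ) ≡ 0ℚ)
                           (updateAt-updates e x) (combination≡0 e)
  μ₁≡0 : μ₁ ≡ 0ℚ
  μ₁≡0 = begin
    μ₁
      ≡⟨ solve 3 (λ m₀ m₁ xₑ → m₁ := (m₀ :* xₑ :+ (m₁ :* (xₑ :+ con 1ℚ) :+ con 0ℚ))
                                      :+ (:- ((m₀ :+ (m₁ :+ con 0ℚ)) :* xₑ))) refl μ₀ μ₁ (x e) ⟩
    (μ₀ * x e + (μ₁ * (x e + 1ℚ) + 0ℚ)) - (μ₀ + (μ₁ + 0ℚ)) * x e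
      ≡⟨ cong₂ (λ u v → u - v * x e) combination-at-e Σμ≡0 ⟩
    0ℚ - 0ℚ * x e
      ≡⟨ cong (λ u → 0ℚ - u) (*-zeroˡ (x e)) ⟩
    0ℚ
      ∎
  μ₀≡0 : μ₀ ≡ 0ℚ
  μ₀≡0 = begin
    μ₀                    ≡⟨ solve 2 (λ m₀ m₁ → m₀ := (m₀ :+ (m₁ :+ con 0ℚ)) :+ (:- m₁)) refl μ₀ μ₁ ⟩
    (μ₀ + (μ₁ + 0ℚ)) - μ₁ ≡⟨ cong₂ _-_ Σμ≡0 μ₁≡0 ⟩
    0ℚ                    ∎

module _ (G : Graph) (S : TerminalPairs G) (a : Point G) (b : ℚ) where

  fullSupport⇒Face-bounded : Valid G S a b → SuppIsG G a → Bounded G (Face G S a b)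
  fullSupport⇒Face-bounded valid aₑ≢0 = M , bound
    where
    instance
      a-nonZero : ∀ {e} → NonZero (a e)
      a-nonZero {e} = ≢-nonZero (aₑ≢0 e)
    M = Σℚ (λ e → ∣ 1/ a e * b ∣)
    bound : ∀ x → Face G S a b x → ∀ e → ∣ x e ∣ ≤ M
    bound x (x∈ , a·x≡b) e = begin
      ∣ x e ∣         ≡⟨ 0≤p⇒∣p∣≡p (x≥0 e) ⟩
      x e             ≤⟨ r*p≤q⇒p≤1/r*q (a e) aₑxₑ≤b ⟩
      1/ a e * b      ≤⟨ p≤∣p∣ _ ⟩
      ∣ 1/ a e * b ∣  ≤⟨ term≤Σℚ _ (λ e → 0≤∣p∣ (1/ a e * b)) e ⟩
      M               ∎
      where
      open ≤-Reasoning
      x≥0 = InMultC-nonNeg G S x∈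
      a≥0 = Valid⇒nonNeg G S a valid x∈
      instance
        aₑ-positive : Positive (a e)
        aₑ-positive = nonNeg∧nonZero⇒pos (a e) {{nonNegative (a≥0 e)}}
      aₑxₑ≤b : a e * x e ≤ b
      aₑxₑ≤b = subst (a e * x e ≤_) a·x≡b
        (term≤Σℚ (λ i → a i * x i) (λ i → *-nonNeg (a≥0 i) (x≥0 i)) e)

  Face-bounded⇒fullSupport : FacetDefining G S a b → Bounded G (Face G S a b) → SuppIsG G a
  -- A facet of MultC has a point: MultC itself has affine rank ≥ 2, as it contains x and x + χ^e.
  Face-bounded⇒fullSupport (_ , ℕ.zero , ((p , p∈ , _) , no-two-points) , _) _ e _ =
    no-two-points (x ∷ updateAt x e (_+ 1ℚ) ∷ [] , two-points∈ , updateAt-+1-affinelyIndependent G x e)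
    where
    x = p zero
    two-points∈ : ∀ i → InMultC G S ((x ∷ updateAt x e (_+ 1ℚ) ∷ []) i)
    two-points∈ zero       = p∈ zero
    two-points∈ (suc zero) = InMultC-ray G S e (nonNegative⁻¹ 1ℚ) (p∈ zero)
  Face-bounded⇒fullSupport (_ , ℕ.suc _ , _ , ((p , p∈ , _) , _)) bounded e aₑ≡0 =
    ray⇒¬Bounded G (Face G S a b) (p zero) e (InMultC-nonNeg G S (proj₁ (p∈ zero)) e)
      (λ t 0≤t → Face-ray G S a e aₑ≡0 0≤t (p∈ zero)) bounded

theorem3p5 : (G : Graph) → Simple G → (S : TerminalPairs G) → DistinctPairs G S →
    (a : Point G) (b : ℚ) → FacetDefining G S a b →
    (Bounded G (Face G S a b) ⇔ SuppIsG G a)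
theorem3p5 G _ S _ a b facet@(valid , _) =
  mk⇔ (Face-bounded⇒fullSupport G S a b facet) (fullSupport⇒Face-bounded G S a b valid)
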